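{- Let $r\ge1$, $s\ge3$, and $k_1,\dots,k_{s-1},\ell\in[r]$. If $x=(\omega_{k_1},\omega_{k_2},\dots,\omega_{k_{s-1}},\omega_\ell)$ belongs to $\mathsf{EqLR}_r^s$, then $\mathbb{R}_{\ge0}x$ is an extremal ray of $\mathsf{EqLR}_r^s$.
   Context: Points of $\mathbb{R}^{rs}$ are written $(\lambda^1,\dots,\lambda^{s-1},\nu)$ with $\lambda^j,\nu\in\mathbb{R}^r$; $|\lambda|=\sum_i\lambda_i$; $\lambda\subseteq\mu$ means $\lambda_i\le\mu_i$ for all $i$. For $j\in[r]$, $\omega_j=(1,\dots,1,0,\dots,0)\in\mathbb{R}^r$ with $j$ ones. $\tau(\{i_1<\dots<i_e\})=(i_e-e\ge\dots\ge i_1-1)$; $c^{L}_{J_1,\dots,J_{s-1}}$ (for $e$-element sets) is the coefficient of $[X_{\tau(L)}]$ in $[X_{\tau(J_1)}]\cdots[X_{\tau(J_{s-1})}]$ in $H^*(\mathrm{Gr}(e,\mathbb{C}^n))$, $n$ large. $\mathsf{EqLR}_r^s$ is the set of points with: each $\lambda^j,\nu$ weakly decreasing; $\lambda^j_r\ge0$ for all $j$; $\lambda^j\subseteq\nu$ for all $j$; $\sum_j|\lambda^j|\ge|\nu|$; and $\sum_j\sum_{a\in J_j}\lambda^j_a\ge\sum_{k\in L}\nu_k$ for every $1\le e<r$ and $e$-subsets $J_1,\dots,J_{s-1},L\subseteq[r]$ with $c^L_{J_1,\dots,J_{s-1}}=1$ (Horn inequalities). It is a pointed convex polyhedral cone;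 an extremal ray is a one-dimensional face.
   Formalization: The cone $\mathsf{EqLR}_r^s$ consists only of points with rational coordinates rather than points of $\mathbb{R}^{rs}$, so the ray $\mathbb{R}_{\ge0}x$ becomes the set of nonnegative rational multiples of x. -}

module Defs where

open import Data.Nat as ℕ using (ℕ; zero; suc; _∸_; _<ᵇ_)
open import Data.Nat.Properties using (_<?_)
open import Data.Bool using (Bool; true; false; if_then_else_; _∧_)
open import Data.Fin as Fin using (Fin; toℕ; opposite)
open import Data.Fin.Properties as FinP using ()
open import Data.List as List using (List; []; _∷_)
open import Data.Product using (Σ; ∃; _×_; _,_; proj₁)
open import Data.Unit using (⊤)
open import Data.Rational as ℚ using (ℚ; 0ℚ; 1ℚ)
open import Relation.Nullary using (¬_)
open import Relation.Nullary.Decidable using (⌊_⌋)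
open import Relation.Binary.PropositionalEquality using (_≡_)

sumℕ : ∀ {n} → (Fin n → ℕ) → ℕ
sumℕ {zero}  f = 0
sumℕ {suc n} f = f Fin.zero ℕ.+ sumℕ (λ i → f (Fin.suc i))

sumℚ : ∀ {n} → (Fin n → ℚ) → ℚ
sumℚ {zero}  f = 0ℚ
sumℚ {suc n} f = f Fin.zero ℚ.+ sumℚ (λ i → f (Fin.suc i))

-- Partitions with (at most) e rows: weakly decreasing maps Fin e → ℕ
-- (row indices 0-based, top row first).

IsPartition : ∀ {e} → (Fin e → ℕ) → Set
IsPartition {e} p = ∀ (a b : Fin e) → toℕ a ℕ.≤ toℕ b → p b ℕ.≤ p a

zeroPart : ∀ {e} → Fin e → ℕ
zeroPart _ = 0

-- Cell (i , c) (column c is 1-based) of the skew shape nu / la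
Cell : ∀ {e} → (la nu : Fin e → ℕ) → Fin e → ℕ → Set
Cell la nu i c = (la i ℕ.< c) × (c ℕ.≤ nu i)

countRow : ∀ {e} → (ℕ → Fin e) → (lo hi : ℕ) → Fin e → ℕ
countRow f lo zero    k = 0
countRow f lo (suc h) k =
  countRow f lo h k ℕ.+ (if ⌊ lo <? suc h ⌋ ∧ ⌊ f (suc h) Fin.≟ k ⌋ then 1 else 0)

-- number of entries equal to k among the cells of nu/la preceding or
-- equal to cell (i , c) in the (reverse) reading word: rows top to
-- bottom, each row read right to left.
prefixCount : ∀ {e} → (la nu : Fin e → ℕ) → (Fin e → ℕ → Fin e)
            → Fin e → ℕ → Fin e → ℕ
prefixCount la nu fill i c k =
  sumℕ (λ i' → if toℕ i' <ᵇ toℕ i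
                 then countRow (fill i') (la i') (nu i') k else 0)
  ℕ.+ countRow (fill i) (c ∸ 1) (nu i) k

-- Littlewood–Richardson tableau of skew shape nu/la with content mu:
-- a semistandard filling (entries 1..e, encoded as Fin e) whose
-- reverse reading word is a lattice word.
record LRTableau {e : ℕ} (la mu nu : Fin e → ℕ) : Set where
  field
    fill      : Fin e → ℕ → Fin e
    contained : ∀ i → la i ℕ.≤ nu i
    rowWeak   : ∀ i c c' → Cell la nu i c → Cell la nu i c' → c ℕ.≤ c'
              → fill i c Fin.≤ fill i c'
    colStrict : ∀ i i' c → toℕ i' ≡ suc (toℕ i) → Cell la nu i c → Cell la nu i' c
              → fill i c Fin.< fill i' c
    content   : ∀ k → sumℕ (λ i → countRow (fill i) (la i) (nu i) k) ≡ mu k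
    lattice   : ∀ i c → Cell la nu i c → ∀ k k' → toℕ k' ≡ suc (toℕ k)
              → prefixCount la nu fill i c k' ℕ.≤ prefixCount la nu fill i c k

-- Chains start = μ₀ ⊆ μ₁ ⊆ … ⊆ μ_m = end of partitions together with
-- LR tableaux of shape μ_i/μ_{i-1} with content the i-th factor.
-- Their number is the multi-LR coefficient c^{end}_{start, factors...};
-- with start = ∅ it is c^{end}_{factors}.
Chain : ∀ {e} → (Fin e → ℕ) → List (Fin e → ℕ) → (Fin e → ℕ) → Set
Chain start []        end = ∀ i → start i ≡ end i
Chain start (mu ∷ ms) end =
  Σ (_ → ℕ) λ mid → IsPartition mid × LRTableau start mu mid × Chain mid ms end

ChainEq : ∀ {e} {s s' : Fin e → ℕ} (ms : List (Fin e → ℕ)) {end : Fin e → ℕ}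
        → Chain s ms end → Chain s' ms end → Set
ChainEq []        _ _ = ⊤
ChainEq {s = s} (mu ∷ ms) (mid , _ , T , rest) (mid' , _ , T' , rest') =
  (∀ i → mid i ≡ mid' i)
  × (∀ i c → Cell s mid i c → LRTableau.fill T i c ≡ LRTableau.fill T' i c)
  × ChainEq ms rest rest'

ExactlyOne : (A : Set) → (A → A → Set) → Set
ExactlyOne A _≈_ = Σ A λ a → ∀ b → b ≈ a

-- e-element subsets of [r], as strictly increasing maps Fin e → Fin r
-- (i_1 < … < i_e, 0-based).

ESub : ℕ → ℕ → Set
ESub r e = Σ (Fin e → Fin r) λ J → ∀ p q → p Fin.< q → J p Fin.< J q

-- τ({i_1<…<i_e}) = (i_e - e ≥ … ≥ i_1 - 1); row q (0-based, top first)
-- is i_{e-q} - (e-q) = toℕ (J (e-1-q)) - (e-1-q).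
τ : ∀ {r e} → ESub r e → Fin e → ℕ
τ (J , _) q = toℕ (J (opposite q)) ∸ toℕ (opposite q)

-- c^L_{J_1,…,J_m} = 1 (Schubert structure constant of Gr(e,ℂⁿ), n large,
-- computed by the Littlewood–Richardson rule)
LRcoeffOne : ∀ {r e m} → (Fin m → ESub r e) → ESub r e → Set
LRcoeffOne J L =
  ExactlyOne (Chain zeroPart (List.tabulate (λ j → τ (J j))) (τ L))
             (ChainEq (List.tabulate (λ j → τ (J j))))

record Pt (r s : ℕ) : Set where
  constructor pt
  field
    lam : Fin (s ∸ 1) → Fin r → ℚ
    nu  : Fin r → ℚ
open Pt public

WeaklyDecr : ∀ {r} → (Fin r → ℚ) → Set
WeaklyDecr {r} v = ∀ (a b : Fin r) → toℕ a ℕ.≤ toℕ b → v b ℚ.≤ v a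

EqLR : (r s : ℕ) → Pt r s → Set
EqLR r s x =
    (∀ j → WeaklyDecr (lam x j))
  × WeaklyDecr (nu x)
  × (∀ j (a : Fin r) → suc (toℕ a) ≡ r → 0ℚ ℚ.≤ lam x j a)
  × (∀ j a → lam x j a ℚ.≤ nu x a)
  × (sumℚ (nu x) ℚ.≤ sumℚ (λ j → sumℚ (lam x j)))
  × (∀ (e : ℕ) → 1 ℕ.≤ e → e ℕ.< r
       → (J : Fin (s ∸ 1) → ESub r e) (L : ESub r e) → LRcoeffOne J L
       → sumℚ (λ p → nu x (proj₁ L p))
           ℚ.≤ sumℚ (λ j → sumℚ (λ p → lam x j (proj₁ (J j) p))))

_≈ₚ_ : ∀ {r s} → Pt r s → Pt r s → Set
x ≈ₚ y = (∀ j a → lam x j a ≡ lam y j a) × (∀ a → nu x a ≡ nu y a)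

_⊕_ : ∀ {r s} → Pt r s → Pt r s → Pt r s
x ⊕ y = pt (λ j a → lam x j a ℚ.+ lam y j a) (λ a → nu x a ℚ.+ nu y a)

_⊛_ : ∀ {r s} → ℚ → Pt r s → Pt r s
t ⊛ x = pt (λ j a → t ℚ.* lam x j a) (λ a → t ℚ.* nu x a)

IsZero : ∀ {r s} → Pt r s → Set
IsZero x = (∀ j a → lam x j a ≡ 0ℚ) × (∀ a → nu x a ≡ 0ℚ)

Ray : ∀ {r s} → Pt r s → Pt r s → Set
Ray x y = ∃ λ t → (0ℚ ℚ.≤ t) × (y ≈ₚ (t ⊛ x))

IsFace : ∀ {r s} → (Pt r s → Set) → (Pt r s → Set) → Set
IsFace C F = (∀ y → F y → C y)
           × (∀ y z → C y → C z → F (y ⊕ z) → F y × F z)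

ExtremalRay : ∀ {r s} → (Pt r s → Set) → Pt r s → Set
ExtremalRay C x = (¬ IsZero x) × IsFace C (Ray x)

-- ω_{k+1} ∈ ℚ^r (0-based k : Fin r): first k+1 coordinates 1, rest 0
ω : ∀ {r} → Fin r → Fin r → ℚ
ω k a = if toℕ a ℕ.≤ᵇ toℕ k then 1ℚ else 0ℚ

ωpt : ∀ {r s} → (Fin (s ∸ 1) → Fin r) → Fin r → Pt r s
ωpt k l = pt (λ j → ω (k j)) (ω l)

{-# OPTIONS --safe #-}
module Submission where

open import Data.Nat as ℕ using (ℕ; zero; suc; _≤_; _∸_; s≤s; z≤n)
open import Data.Fin as Fin using (Fin; toℕ; fromℕ)
open import Data.Fin.Properties using (toℕ-fromℕ; ≤fromℕ)
open import Data.Bool using (true; false)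
open import Data.Rational as ℚ using (ℚ; 0ℚ; 1ℚ; nonNegative)
import Data.Rational.Properties as ℚₚ
open import Data.Product using (_×_; _,_; proj₁)
open import Data.Sum using (_⊎_; inj₁; inj₂)
open import Relation.Binary.PropositionalEquality
open import Defs

-- If y + z = t x with x a 0/1 point and ν₁(x) = 1, then ν₁(y) + ν₁(z) = t,
-- so at a coordinate where x is 1 both y and z attain their bounds ν₁(y),
-- ν₁(z), and where x is 0 both vanish; hence y = ν₁(y) x.

≤∧≤∧+≡+⇒≡ˡ : ∀ {a b c d : ℚ} → a ℚ.≤ b → c ℚ.≤ d → a ℚ.+ c ≡ b ℚ.+ d → a ≡ b
≤∧≤∧+≡+⇒≡ˡ a≤b c≤d a+c≡b+d = ℚₚ.≤-antisym a≤b
  (ℚₚ.≮⇒≥ (λ a<b → ℚₚ.<-irrefl a+c≡b+d (ℚₚ.+-mono-<-≤ a<b c≤d)))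

scaled-≤ : ∀ {t a b a′ b′ : ℚ} → 0ℚ ℚ.≤ t → a ℚ.≤ b
         → a′ ≡ t ℚ.* a → b′ ≡ t ℚ.* b → a′ ℚ.≤ b′
scaled-≤ {t} 0≤t a≤b refl refl = ℚₚ.*-monoˡ-≤-nonNeg t {{nonNegative 0≤t}} a≤b

sumℚ-scaled : ∀ {n} (t : ℚ) {f g : Fin n → ℚ}
            → (∀ i → f i ≡ t ℚ.* g i) → sumℚ f ≡ t ℚ.* sumℚ g
sumℚ-scaled {zero}  t f≡tg = sym (ℚₚ.*-zeroʳ t)
sumℚ-scaled {suc n} t {f} {g} f≡tg = begin
  f Fin.zero ℚ.+ sumℚ (λ i → f (Fin.suc i))
    ≡⟨ cong₂ ℚ._+_ (f≡tg Fin.zero) (sumℚ-scaled t (λ i → f≡tg (Fin.suc i))) ⟩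
  t ℚ.* g Fin.zero ℚ.+ t ℚ.* sumℚ (λ i → g (Fin.suc i))
    ≡⟨ ℚₚ.*-distribˡ-+ t (g Fin.zero) (sumℚ (λ i → g (Fin.suc i))) ⟨
  t ℚ.* sumℚ g ∎
  where open ≡-Reasoning

ZeroOne : ℚ → Set
ZeroOne v = v ≡ 1ℚ ⊎ v ≡ 0ℚ

share-of-multiple : ∀ {a b A B t v : ℚ}
                  → 0ℚ ℚ.≤ a × a ℚ.≤ A → 0ℚ ℚ.≤ b × b ℚ.≤ B → A ℚ.+ B ≡ t
                  → ZeroOne v → a ℚ.+ b ≡ t ℚ.* v → a ≡ A ℚ.* v
share-of-multiple {A = A} {t = t} (_ , a≤A) (_ , b≤B) A+B≡t (inj₁ refl) a+b≡t =
  trans (≤∧≤∧+≡+⇒≡ˡ a≤A b≤B (trans a+b≡t (trans (ℚₚ.*-identityʳ t) (sym A+B≡t))))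
        (sym (ℚₚ.*-identityʳ A))
share-of-multiple {A = A} {t = t} (0≤a , _) (0≤b , _) _ (inj₂ refl) a+b≡0 =
  trans (sym (≤∧≤∧+≡+⇒≡ˡ 0≤a 0≤b (trans (ℚₚ.+-identityʳ 0ℚ)
                                        (sym (trans a+b≡0 (ℚₚ.*-zeroʳ t))))))
        (sym (ℚₚ.*-zeroʳ A))

ZeroOnePt : ∀ {r s} → Pt r s → Set
ZeroOnePt x = (∀ j a → ZeroOne (lam x j a)) × (∀ a → ZeroOne (nu x a))

BoundedByNu₀ : ∀ {r s} → Pt (suc r) s → Set
BoundedByNu₀ y = (∀ j a → 0ℚ ℚ.≤ lam y j a × lam y j a ℚ.≤ nu y Fin.zero)
               × (∀ a → 0ℚ ℚ.≤ nu y a × nu y a ℚ.≤ nu y Fin.zero)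

ClosedUnderScaling : ∀ {r s} → (Pt r s → Set) → Set
ClosedUnderScaling C = ∀ {t x y} → 0ℚ ℚ.≤ t → y ≈ₚ (t ⊛ x) → C x → C y

Ray-⊕-comm : ∀ {r s} {x y z : Pt r s} → Ray x (y ⊕ z) → Ray x (z ⊕ y)
Ray-⊕-comm {y = y} {z} (t , 0≤t , lam≈ , nu≈) =
  t , 0≤t , (λ j a → trans (ℚₚ.+-comm (lam z j a) (lam y j a)) (lam≈ j a))
          , (λ a → trans (ℚₚ.+-comm (nu z a) (nu y a)) (nu≈ a))

Ray-⊕⇒Rayˡ : ∀ {r s} {x y z : Pt (suc r) s} → ZeroOnePt x → nu x Fin.zero ≡ 1ℚ
           → BoundedByNu₀ y → BoundedByNu₀ z → Ray x (y ⊕ z) → Ray x y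
Ray-⊕⇒Rayˡ {y = y} {z} (lam01 , nu01) x₀≡1 (yλ , yν) (zλ , zν) (t , _ , lam≈ , nu≈) =
  nu y Fin.zero , proj₁ (yν Fin.zero)
  , (λ j a → share-of-multiple (yλ j a) (zλ j a) y₀+z₀≡t (lam01 j a) (lam≈ j a))
  , (λ a → share-of-multiple (yν a) (zν a) y₀+z₀≡t (nu01 a) (nu≈ a))
  where
  y₀+z₀≡t : nu y Fin.zero ℚ.+ nu z Fin.zero ≡ t
  y₀+z₀≡t = trans (nu≈ Fin.zero) (trans (cong (t ℚ.*_) x₀≡1) (ℚₚ.*-identityʳ t))

ZeroOnePt⇒ExtremalRay : ∀ {r s} (C : Pt (suc r) s → Set) (x : Pt (suc r) s)
                      → ClosedUnderScaling C → (∀ {y} → C y → BoundedByNu₀ y)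
                      → ZeroOnePt x → nu x Fin.zero ≡ 1ℚ → C x → ExtremalRay C x
ZeroOnePt⇒ExtremalRay C x scale bounded x01 x₀≡1 x∈C =
  (λ (_ , nu≡0) → ℚₚ.1≢0 (trans (sym x₀≡1) (nu≡0 Fin.zero)))
  , (λ y (t , 0≤t , y≈tx) → scale {x = x} {y} 0≤t y≈tx x∈C)
  , λ y z y∈C z∈C y+z∈ray →
      Ray-⊕⇒Rayˡ {x = x} {y} {z} x01 x₀≡1 (bounded y∈C) (bounded z∈C) y+z∈ray
    , Ray-⊕⇒Rayˡ {x = x} {z} {y} x01 x₀≡1 (bounded z∈C) (bounded y∈C)
                 (Ray-⊕-comm {x = x} {y} {z} y+z∈ray)

EqLR-closedUnderScaling : ∀ r s → ClosedUnderScaling (EqLR r s)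
EqLR-closedUnderScaling _ _ {t = t} 0≤t (lam≈ , nu≈)
  (decλ , decν , lastλ≥0 , λ⊆ν , sumν≤sumλ , horn) =
    (λ j a b a≤b → scaled-≤ 0≤t (decλ j a b a≤b) (lam≈ j b) (lam≈ j a))
  , (λ a b a≤b → scaled-≤ 0≤t (decν a b a≤b) (nu≈ b) (nu≈ a))
  , (λ j a a-last → scaled-≤ 0≤t (lastλ≥0 j a a-last) (sym (ℚₚ.*-zeroʳ t)) (lam≈ j a))
  , (λ j a → scaled-≤ 0≤t (λ⊆ν j a) (lam≈ j a) (nu≈ a))
  , scaled-≤ 0≤t sumν≤sumλ (sumℚ-scaled t nu≈)
      (sumℚ-scaled t (λ j → sumℚ-scaled t (lam≈ j)))
  , λ e 1≤e e<r J L c=1 → scaled-≤ 0≤t (horn e 1≤e e<r J L c=1)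
      (sumℚ-scaled t (λ p → nu≈ (proj₁ L p)))
      (sumℚ-scaled t (λ j → sumℚ-scaled t (λ p → lam≈ j (proj₁ (J j) p))))

EqLR⇒BoundedByNu₀ : ∀ {r m} {y : Pt (suc r) (suc (suc m))}
                  → EqLR (suc r) (suc (suc m)) y → BoundedByNu₀ y
EqLR⇒BoundedByNu₀ {r} {y = y} (decλ , decν , lastλ≥0 , λ⊆ν , _) =
    (λ j a → lam≥0 j a , ℚₚ.≤-trans (decλ j Fin.zero a z≤n) (λ⊆ν j Fin.zero))
  , (λ a → ℚₚ.≤-trans (lam≥0 Fin.zero a) (λ⊆ν Fin.zero a) , decν Fin.zero a z≤n)
  where
  lam≥0 : ∀ j a → 0ℚ ℚ.≤ lam y j a
  lam≥0 j a = ℚₚ.≤-trans (lastλ≥0 j (fromℕ r) (cong suc (toℕ-fromℕ r)))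
                         (decλ j a (fromℕ r) (≤fromℕ a))

ω-zeroOne : ∀ {r} (k a : Fin r) → ZeroOne (ω k a)
ω-zeroOne k a with toℕ a ℕ.≤ᵇ toℕ k
... | true  = inj₁ refl
... | false = inj₂ refl

ωpt-zeroOne : ∀ {r s} (k : Fin (s ∸ 1) → Fin r) (l : Fin r) → ZeroOnePt {r} {s} (ωpt k l)
ωpt-zeroOne k l = (λ j → ω-zeroOne (k j)) , ω-zeroOne l

lemma5p1 : (r s : ℕ) → 1 ≤ r → 3 ≤ s
         → (k : Fin (s ∸ 1) → Fin r) (l : Fin r)
         → EqLR r s (ωpt k l)
         → ExtremalRay (EqLR r s) (ωpt k l)
lemma5p1 r@(suc _) s@(suc (suc (suc _))) _ _ k l x∈EqLR =
  ZeroOnePt⇒ExtremalRay (EqLR r s) (ωpt k l) (EqLR-closedUnderScaling r s)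
    EqLR⇒BoundedByNu₀ (ωpt-zeroOne {s = s} k l) refl x∈EqLR
lemma5p1 (suc r) (suc zero)       _ (s≤s ())       k l
lemma5p1 (suc r) (suc (suc zero)) _ (s≤s (s≤s ())) k l
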